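{- For every infinite set $X\subseteq\mathbb{N}$ there is an infinite strictly descending chain $X=X_0\supsetneq X_1\supsetneq X_2\supsetneq\cdots$ of infinite subsets of $\mathbb{N}$ such that $X_i\not\leq_{fe}X_{i+1}$ for every $i\in\mathbb{N}$.
   Context: $\mathbb{N}=\{0,1,2,\dots\}$. For $A,B\subseteq\mathbb{N}$, $A\leq_{fe}B$ means that for every finite $F\subseteq A$ there is $k\in\mathbb{N}$ with $F+k\subseteq B$. -}

module Defs where

open import Data.Nat using (ℕ; _+_; _≥_)
open import Data.Product using (Σ; ∃; _×_)
open import Data.List using (List)
open import Data.List.Relation.Unary.All using (All)
open import Relation.Nullary using (¬_)
open import Relation.Unary using (Pred; _⊆_)

Subset : Set₁
Subset = Pred ℕ _

Infinite : Subset → Set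
Infinite A = ∀ n → ∃ λ m → m ≥ n × A m

_⊊_ : Subset → Subset → Set
B ⊊ A = (B ⊆ A) × (∃ λ m → A m × ¬ B m)

-- A ≤fe B : every finite F ⊆ A (given as a list of elements of A) has a
-- shift k with F + k ⊆ B.
_≤fe_ : Subset → Subset → Set
A ≤fe B = (F : List ℕ) → All A F → ∃ λ k → All (λ x → B (x + k)) F

-- Pick a < b in Y and thin Y out to an infinite subset Z whose elements lie above a
-- and are pairwise more than b apart. Then a ∈ Y ∖ Z, and no shift of {a, b} fits
-- into Z: the two shifted points would be distinct elements of Z at distance
-- b − a ≤ b. Iterating this thinning from Y = X gives the chain.
module Submission where

open import Defs
open import Data.Nat using (ℕ; zero; suc; _+_; _≤_; _<_; s≤s)
open import Data.Nat.GeneralisedArithmetic using (fold)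
open import Data.Nat.Properties
open import Data.Product using (Σ; ∃; _×_; _,_; proj₁; proj₂)
open import Data.List using ([]; _∷_)
open import Data.List.Relation.Unary.All using ([]; _∷_)
open import Data.Empty using (⊥; ⊥-elim)
open import Data.Sum using (inj₁; inj₂)
open import Relation.Binary.Definitions using (tri<; tri≈; tri>)
open import Relation.Nullary using (¬_)
open import Relation.Unary using (_⊆_)
open import Relation.Binary.PropositionalEquality using (_≡_; refl)

Separated : ℕ → Subset → Set
Separated d Z = ∀ {m n} → Z m → Z n → m < n → m + d < n

separated-no-shifted-pair : ∀ {d a b} {Z : Subset} → Separated d Z → a < b → b ≤ d →
                            ∀ k → Z (a + k) → Z (b + k) → ⊥
separated-no-shifted-pair {d} {a} {b} sep a<b b≤d k Za+k Zb+k = <-irrefl refl (begin-strict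
  a + k + d  <⟨ sep Za+k Zb+k (+-monoˡ-< k a<b) ⟩
  b + k      ≤⟨ +-monoˡ-≤ k b≤d ⟩
  d + k      ≡⟨ +-comm d k ⟩
  k + d      ≤⟨ +-monoˡ-≤ d (m≤n+m k a) ⟩
  a + k + d  ∎)
  where open ≤-Reasoning

separated-≰fe : ∀ {a b} {Y Z : Subset} → Separated b Z → Y a → Y b → a < b → ¬ (Y ≤fe Z)
separated-≰fe sep Ya Yb a<b fe with fe (_ ∷ _ ∷ []) (Ya ∷ Yb ∷ [])
... | k , Za+k ∷ Zb+k ∷ [] = separated-no-shifted-pair sep a<b ≤-refl k Za+k Zb+k

module Thinning {Y : Subset} (inf : Infinite Y) (d n : ℕ) where

  pick : ℕ → ℕ
  pick zero    = proj₁ (inf n)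
  pick (suc j) = proj₁ (inf (suc (pick j + d)))

  pick-∈ : ∀ j → Y (pick j)
  pick-∈ zero    = proj₂ (proj₂ (inf n))
  pick-∈ (suc j) = proj₂ (proj₂ (inf (suc (pick j + d))))

  pick-gap : ∀ j → pick j + d < pick (suc j)
  pick-gap j = proj₁ (proj₂ (inf (suc (pick j + d))))

  pick-separated : ∀ {i j} → i < j → pick i + d < pick j
  pick-separated {i} {suc j} (s≤s i≤j) with m≤n⇒m<n∨m≡n i≤j
  ... | inj₁ i<j  = <-≤-trans (pick-separated i<j) (m+n≤o⇒m≤o (pick j) (<⇒≤ (pick-gap j)))
  ... | inj₂ refl = pick-gap j

  pick-≥ : ∀ j → j + n ≤ pick j
  pick-≥ zero    = proj₁ (proj₂ (inf n))
  pick-≥ (suc j) = ≤-trans (s≤s (≤-trans (pick-≥ j) (m≤m+n (pick j) d))) (pick-gap j)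

  Range : Subset
  Range m = ∃ λ j → pick j ≡ m

  range-separated : Separated d Range
  range-separated (i , refl) (j , refl) pi<pj with <-cmp i j
  ... | tri< i<j _ _ = pick-separated i<j
  ... | tri≈ _ refl _ = ⊥-elim (<-irrefl refl pi<pj)
  ... | tri> _ _ j<i = ⊥-elim (<-asym pi<pj (m+n≤o⇒m≤o (suc (pick j)) (pick-separated j<i)))

infinite⇒separated-subset : ∀ {Y : Subset} → Infinite Y → (d n : ℕ) →
  ∃ λ Z → Z ⊆ Y × Infinite Z × Separated d Z × (∀ {m} → Z m → n ≤ m)
infinite⇒separated-subset inf d n =
  Range , (λ { (j , refl) → pick-∈ j }) ,
  (λ m → pick m , m+n≤o⇒m≤o m (pick-≥ m) , m , refl) ,
  range-separated , (λ { (j , refl) → m+n≤o⇒n≤o j (pick-≥ j) })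
  where open Thinning inf d n

thin-step : ∀ {Y : Subset} → Infinite Y → ∃ λ Z → Infinite Z × Z ⊊ Y × ¬ (Y ≤fe Z)
thin-step inf with inf 0
... | a , _ , Ya with inf (suc a)
... | b , a<b , Yb with infinite⇒separated-subset inf b (suc a)
... | Z , Z⊆Y , infZ , sepZ , Z>a =
  Z , infZ , (Z⊆Y , a , Ya , λ Za → <-irrefl refl (Z>a Za)) , separated-≰fe sepZ Ya Yb a<b

thin : Σ Subset Infinite → Σ Subset Infinite
thin (Y , inf) = proj₁ (thin-step inf) , proj₁ (proj₂ (thin-step inf))

corollary10 : (X : Subset) → Infinite X →
    Σ (ℕ → Subset) λ Xs →
    (Xs zero ≡ X) ×
    ((i : ℕ) → Infinite (Xs i)) ×
    ((i : ℕ) → Xs (suc i) ⊊ Xs i) ×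
    ((i : ℕ) → ¬ (Xs i ≤fe Xs (suc i)))
corollary10 X inf = Xs , refl , (λ i → proj₂ (chain i)) , (λ i → proj₁ (thinned i)) , (λ i → proj₂ (thinned i))
  where
  chain : ℕ → Σ Subset Infinite
  chain = fold (X , inf) thin

  Xs : ℕ → Subset
  Xs i = proj₁ (chain i)

  thinned : ∀ i → Xs (suc i) ⊊ Xs i × ¬ (Xs i ≤fe Xs (suc i))
  thinned i = proj₂ (proj₂ (thin-step (proj₂ (chain i))))
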